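{- Let $q$ be a prime power with $q=ef+1=\epsilon\rho+1$, where $e,f,\epsilon,\rho>1$ are integers and $\epsilon\mid e$. (a) Let $q\equiv 1\pmod{2\epsilon}$ and suppose $\phi_1=\phi_j$ for all $1\le j\le\epsilon-1$. Then: (i) if $f$ is odd, $\phi_0=2\psi_0$ and $\phi_1=2\psi_1$; (ii) if $f$ is even and $\epsilon>2$, $\phi_0=2\psi_0+1$ and $\phi_1=2\psi_1$; (iii) if $f$ is even, $\epsilon=2$ and $q\equiv 1\pmod 8$, $\phi_0=2\psi_0+1$ and $\phi_1=2\psi_1$; (iv) if $f$ is even, $\epsilon=2$ and $q\equiv 5\pmod 8$, $\phi_0=2\psi_0$ and $\phi_1=2\psi_1+1$. (b) Let $q\equiv\epsilon+1\pmod{2\epsilon}$ with $\epsilon$ odd, and suppose $\phi_1=\phi_j$ for all $1\le j\le\epsilon-1$. Then $\phi_0=2\psi_0$ and $\phi_1=2\psi_1$. (c) Let $q\equiv\epsilon+1\pmod{2\epsilon}$ with $\epsilon$ even. Then $\phi_0=\phi_{\epsilon/2}$.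
   Context: Let $\alpha$ be a fixed primitive element of $GF(q)$. For a divisor $d$ of $q-1$ and $0\le i\le d-1$, the cyclotomic class of order $d$ is $C_i^d=\alpha^i\langle\alpha^d\rangle$. For $0\le i\le\epsilon-1$ define $\Phi_i=\{x\in C_0^e: x\neq 1,\ x-1\in\alpha^iC_0^\epsilon\}$ and $\phi_i=|\Phi_i|$, and $\Psi_i=\{r: 1\le r<f/2,\ \alpha^{re}\in\Phi_i\}$ and $\psi_i=|\Psi_i|$. -}

module Defs where

open import Level using (Level; _⊔_; Lift; lift; lower) renaming (suc to lsuc)
open import Data.Nat using (ℕ; zero; suc; _∸_; _<_; _≤_)
import Data.Nat as N
open import Data.Nat.Properties using (_<?_; _≤?_)
open import Data.Fin using (Fin; toℕ)
import Data.Fin as Fin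
import Relation.Nullary.Decidable
open import Data.Product using (Σ; _×_; _,_; ∃-syntax)
open import Data.Sum using (_⊎_; inj₁; inj₂)
open import Relation.Nullary using (¬_; Dec; yes; no)
open import Relation.Nullary.Decidable using (_×-dec_; ¬?)
open import Relation.Binary.PropositionalEquality using (_≡_)
open import Algebra.Bundles using (CommutativeRing; Semiring)
import Algebra.Definitions.RawSemiring as RS

countBelow : {ℓ : Level} (n : ℕ) (P : ℕ → Set ℓ) → (∀ k → Dec (P k)) → ℕ
countBelow zero    P P? = 0
countBelow (suc n) P P? with P? n
... | yes _ = suc (countBelow n P P?)
... | no  _ = countBelow n P P?

∃<? : {ℓ : Level} (n : ℕ) (P : ℕ → Set ℓ) → (∀ k → Dec (P k)) →
      Dec (Σ ℕ λ k → k < n × P k)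
∃<? zero P P? = no λ { (k , () , _) }
∃<? (suc n) P P? with P? n
... | yes p = yes (n , Data.Nat.Properties.n<1+n n , p)
  where import Data.Nat.Properties
... | no ¬p with ∃<? n P P?
...   | yes (k , k<n , pk) = yes (k , Data.Nat.Properties.m<n⇒m<1+n k<n , pk)
  where import Data.Nat.Properties
...   | no ¬e = no λ { (k , k<sn , pk) → helper k k<sn pk }
  where
  import Data.Nat.Properties as NP
  helper : ∀ k → k < suc n → P k → _
  helper k k<sn pk with NP.m<1+n⇒m<n∨m≡n k<sn
  ... | inj₁ k<n = ¬e (k , k<n , pk)
  ... | inj₂ Relation.Binary.PropositionalEquality.refl = ¬p pk

record FiniteField (c ℓ : Level) (q : ℕ) : Set (lsuc (c ⊔ ℓ)) where
  field
    commRing : CommutativeRing c ℓ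
  open CommutativeRing commRing public
  open RS (Semiring.rawSemiring semiring) public using (_^_)
  field
    _≈?_     : (x y : Carrier) → Dec (x ≈ y)
    0≉1      : ¬ (0# ≈ 1#)
    inverse  : (x : Carrier) → ¬ (x ≈ 0#) → Σ Carrier λ y → x * y ≈ 1#
    enum     : Fin q → Carrier
    enum-inj : ∀ i j → enum i ≈ enum j → i ≡ j
    enum-sur : ∀ x → Σ (Fin q) λ i → enum i ≈ x
    α        : Carrier
    α-order  : α ^ (q ∸ 1) ≈ 1#
    α-prim   : ∀ k → 0 < k → k < q ∸ 1 → ¬ (α ^ k ≈ 1#)

countFin : {ℓ : Level} (n : ℕ) (P : Fin n → Set ℓ) → (∀ i → Dec (P i)) → ℕ
countFin zero    P P? = 0
countFin (suc n) P P? with P? Fin.zero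
... | yes _ = suc (countFin n (λ i → P (Fin.suc i)) (λ i → P? (Fin.suc i)))
... | no  _ = countFin n (λ i → P (Fin.suc i)) (λ i → P? (Fin.suc i))

module Cyclotomy {c ℓ : Level} {q : ℕ} (F : FiniteField c ℓ q) where
  open FiniteField F

  -- x ∈ C_i^d = α^i ⟨α^d⟩, where ⟨α^d⟩ = { α^(d k) : k ∈ ℕ }.  Since
  -- α^(q-1) = 1, the exponents k < q already give every element of ⟨α^d⟩.
  InC : (d i : ℕ) → Carrier → Set ℓ
  InC d i x = Σ ℕ λ k → k < q × (x ≈ α ^ i * α ^ (d N.* k))

  InC? : (d i : ℕ) → (x : Carrier) → Dec (InC d i x)
  InC? d i x = ∃<? q (λ k → x ≈ α ^ i * α ^ (d N.* k))
                   (λ k → x ≈? (α ^ i * α ^ (d N.* k)))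

  InΦ : (e ε i : ℕ) → Carrier → Set ℓ
  InΦ e ε i x = InC e 0 x × (¬ (x ≈ 1#)) × InC ε i (x - 1#)

  InΦ? : (e ε i : ℕ) → (x : Carrier) → Dec (InΦ e ε i x)
  InΦ? e ε i x = InC? e 0 x ×-dec (¬? (x ≈? 1#) ×-dec InC? ε i (x - 1#))

  φ : (e ε i : ℕ) → ℕ
  φ e ε i = countFin q (λ j → InΦ e ε i (enum j)) (λ j → InΦ? e ε i (enum j))

  -- Ψ_i = { r : 1 ≤ r < f/2 , α^(r e) ∈ Φ_i }  (r < f/2 written as 2 r < f)
  InΨ : (e f ε i : ℕ) → ℕ → Set ℓ
  InΨ e f ε i r = Lift ℓ (1 ≤ r × 2 N.* r < f) × InΦ e ε i (α ^ (r N.* e))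

  InΨ? : (e f ε i r : ℕ) → Dec (InΨ e f ε i r)
  InΨ? e f ε i r = Relation.Nullary.Decidable.map′ (lift) lower ((1 ≤? r) ×-dec (2 N.* r <? f))
                   ×-dec InΦ? e ε i (α ^ (r N.* e))

  ψ : (e f ε i : ℕ) → ℕ
  ψ e f ε i = countBelow f (InΨ e f ε i) (InΨ? e f ε i)

module Submission where

-- Φ_i consists of elements α^(r e) with 0 < r < f, so φ_i counts such exponents r and ψ_i those with 2 r < f.
-- Inversion x ↦ x⁻¹ = α^((f - r) e) turns x - 1 into - x⁻¹ (x - 1); hence if -1 ∈ C_a^ε it maps Φ_i into Φ_(i+a).
-- In (a) and (b), -1 ∈ C_0^ε, so the exponents of Φ_i are symmetric about f/2 and φ_i = 2 ψ_i, plus, when f is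
-- even, 1 or 0 according as α^(f e / 2) = -1 lies in Φ_i, i.e. as -2 ∈ C_i^ε.  Exactly one class contains -2:
-- in (a)(ii) the equalities φ_1 = φ_j force it to be C_0, and for ε = 2 the identity -2 = (1 + ι)² ι with
-- ι = α^((q-1)/4) decides it from q mod 8.  In (c), -1 ∈ C_(ε/2)^ε and inversion identifies Φ_0 with Φ_(ε/2).

open import Level using (Level; lift)
open import Data.Product using (Σ; _×_; _,_; proj₁; proj₂)
open import Data.Empty using (⊥-elim)
open import Data.Sum using (_⊎_; inj₁; inj₂)
open import Relation.Nullary using (¬_; Dec; yes; no; _×-dec_; _⊎-dec_)
open import Relation.Binary.PropositionalEquality using (_≡_)
import Relation.Binary.PropositionalEquality as ≡
import Relation.Binary.Reasoning.Setoid
open import Data.Nat as Nat using (ℕ; zero; suc; _∸_; _<_; _≤_; NonZero; _%_; _/_)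
import Data.Nat.DivMod
open import Data.Nat.Divisibility using (_∣_; divides; quotient; m∣n⇒n≡quotient*m; ∣n⇒∣m*n)
import Data.Nat.Properties as ℕₚ
open import Defs

module IndicatorSums where

  open import Data.Nat
  open import Data.Nat.Properties
  open import Data.Fin using (Fin)
  import Data.Fin as Fin
  import Data.Fin.Properties as Fin
  open import Function using (case_of_)
  open import Relation.Binary using (tri<; tri≈; tri>)
  open import Relation.Binary.PropositionalEquality
  open import Algebra.Properties.CommutativeSemigroup +-commutativeSemigroup using (interchange; x∙yz≈y∙xz; xy∙z≈xz∙y)

  private
    variable
      a b : Level
      A B : Set a

  𝟙 : Dec A → ℕ
  𝟙 (yes _) = 1
  𝟙 (no _)  = 0

  𝟙-yes : (a? : Dec A) → A → 𝟙 a? ≡ 1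
  𝟙-yes (yes _) _ = refl
  𝟙-yes (no ¬a) a = ⊥-elim (¬a a)

  𝟙-no : (a? : Dec A) → ¬ A → 𝟙 a? ≡ 0
  𝟙-no (yes a) ¬a = ⊥-elim (¬a a)
  𝟙-no (no _)  _  = refl

  𝟙-cong : (a? : Dec A) (b? : Dec B) → (A → B) → (B → A) → 𝟙 a? ≡ 𝟙 b?
  𝟙-cong (yes a) b? to from = sym (𝟙-yes b? (to a))
  𝟙-cong (no ¬a) b? to from = sym (𝟙-no b? (λ b → ¬a (from b)))

  𝟙-× : (a? : Dec A) (b? : Dec B) → 𝟙 (a? ×-dec b?) ≡ 𝟙 a? * 𝟙 b?
  𝟙-× (yes _) (yes _) = refl
  𝟙-× (yes _) (no _)  = refl
  𝟙-× (no _)  _       = refl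

  sum< : ℕ → (ℕ → ℕ) → ℕ
  sum< zero    g = 0
  sum< (suc n) g = g n + sum< n g

  countBelow≡sum< : ∀ n (P : ℕ → Set a) (P? : ∀ k → Dec (P k)) →
                    countBelow n P P? ≡ sum< n (λ k → 𝟙 (P? k))
  countBelow≡sum< zero    P P? = refl
  countBelow≡sum< (suc n) P P? with P? n
  ... | yes _ = cong suc (countBelow≡sum< n P P?)
  ... | no _  = countBelow≡sum< n P P?

  countBelow-all : ∀ n (P : ℕ → Set a) (P? : ∀ k → Dec (P k)) →
                   (∀ k → k < n → P k) → countBelow n P P? ≡ n
  countBelow-all zero    P P? all = refl
  countBelow-all (suc n) P P? all with P? n
  ... | yes _  = cong suc (countBelow-all n P P? (λ k k<n → all k (m<n⇒m<1+n k<n)))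
  ... | no ¬pn = ⊥-elim (¬pn (all n ≤-refl))

  sum<-cong : ∀ n {g h : ℕ → ℕ} → (∀ k → k < n → g k ≡ h k) → sum< n g ≡ sum< n h
  sum<-cong zero    eq = refl
  sum<-cong (suc n) eq = cong₂ _+_ (eq n ≤-refl) (sum<-cong n (λ k k<n → eq k (m<n⇒m<1+n k<n)))

  sum<-zero : ∀ n {g : ℕ → ℕ} → (∀ k → k < n → g k ≡ 0) → sum< n g ≡ 0
  sum<-zero zero    eq = refl
  sum<-zero (suc n) eq = cong₂ _+_ (eq n ≤-refl) (sum<-zero n (λ k k<n → eq k (m<n⇒m<1+n k<n)))

  sum<-+ : ∀ n (g h : ℕ → ℕ) → sum< n (λ k → g k + h k) ≡ sum< n g + sum< n h
  sum<-+ zero    g h = refl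
  sum<-+ (suc n) g h = begin
    (g n + h n) + sum< n (λ k → g k + h k) ≡⟨ cong ((g n + h n) +_) (sum<-+ n g h) ⟩
    (g n + h n) + (sum< n g + sum< n h)     ≡⟨ interchange (g n) (h n) (sum< n g) (sum< n h) ⟩
    (g n + sum< n g) + (h n + sum< n h)     ∎
    where open ≡-Reasoning

  sum<-delta : ∀ n {Q : ℕ → Set a} (Q? : ∀ k → Dec (Q k)) (g : ℕ → ℕ) {k₀} → k₀ < n → Q k₀ →
               (∀ k k′ → k < n → k′ < n → Q k → Q k′ → k ≡ k′) →
               sum< n (λ k → 𝟙 (Q? k) * g k) ≡ g k₀
  sum<-delta (suc n) Q? g {k₀} k₀<1+n qk₀ unique with Q? n
  ... | yes qn = trans (cong₂ _+_ (+-identityʳ (g n)) rest) (trans (+-identityʳ (g n)) (cong g n≡k₀))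
    where
    n≡k₀ : n ≡ k₀
    n≡k₀ = unique n k₀ ≤-refl k₀<1+n qn qk₀
    rest : sum< n (λ k → 𝟙 (Q? k) * g k) ≡ 0
    rest = sum<-zero n λ k k<n →
      cong (_* g k) (𝟙-no (Q? k) λ qk → <-irrefl (unique k n (m<n⇒m<1+n k<n) ≤-refl qk qn) k<n)
  ... | no ¬qn with m<1+n⇒m<n∨m≡n k₀<1+n
  ...   | inj₁ k₀<n = sum<-delta n Q? g k₀<n qk₀ λ k k′ k<n k′<n → unique k k′ (m<n⇒m<1+n k<n) (m<n⇒m<1+n k′<n)
  ...   | inj₂ refl = ⊥-elim (¬qn qk₀)

  sum<-shift : ∀ n (g : ℕ → ℕ) → sum< (suc n) g ≡ g 0 + sum< n (λ k → g (suc k))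
  sum<-shift zero    g = refl
  sum<-shift (suc n) g = begin
    g (suc n) + sum< (suc n) g                      ≡⟨ cong (g (suc n) +_) (sum<-shift n g) ⟩
    g (suc n) + (g 0 + sum< n (λ k → g (suc k)))    ≡⟨ x∙yz≈y∙xz (g (suc n)) (g 0) (sum< n (λ k → g (suc k))) ⟩
    g 0 + (g (suc n) + sum< n (λ k → g (suc k)))    ∎
    where open ≡-Reasoning

  sum<-reverse : ∀ n (g : ℕ → ℕ) → sum< n g ≡ sum< n (λ k → g (n ∸ suc k))
  sum<-reverse zero    g = refl
  sum<-reverse (suc n) g = begin
    sum< (suc n) g                                 ≡⟨ sum<-shift n g ⟩
    g 0 + sum< n (λ k → g (suc k))                 ≡⟨ cong (g 0 +_) (sum<-reverse n (λ k → g (suc k))) ⟩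
    g 0 + sum< n (λ k → g (suc (n ∸ suc k)))       ≡⟨ cong₂ _+_ (cong g (sym (n∸n≡0 n)))
                                                        (sum<-cong n λ k k<n → cong g (sym (+-∸-assoc 1 k<n))) ⟩
    g (n ∸ n) + sum< n (λ k → g (suc n ∸ suc k))   ∎
    where open ≡-Reasoning

  sum<-reflect : ∀ n (g : ℕ → ℕ) → g 0 ≡ 0 → g n ≡ 0 → sum< n g ≡ sum< n (λ k → g (n ∸ k))
  sum<-reflect n g g0≡0 gn≡0 = begin
    sum< n g                             ≡⟨ cong (_+ sum< n g) gn≡0 ⟨
    sum< (suc n) g                       ≡⟨ sum<-reverse (suc n) g ⟩
    g (n ∸ n) + sum< n (λ k → g (n ∸ k)) ≡⟨ cong (_+ sum< n (λ k → g (n ∸ k))) (trans (cong g (n∸n≡0 n)) g0≡0) ⟩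
    sum< n (λ k → g (n ∸ k))             ∎
    where open ≡-Reasoning

  sumFin : (n : ℕ) → (Fin n → ℕ) → ℕ
  sumFin zero    g = 0
  sumFin (suc n) g = g Fin.zero + sumFin n (λ j → g (Fin.suc j))

  countFin≡sumFin : ∀ n (P : Fin n → Set a) (P? : ∀ j → Dec (P j)) →
                    countFin n P P? ≡ sumFin n (λ j → 𝟙 (P? j))
  countFin≡sumFin zero    P P? = refl
  countFin≡sumFin (suc n) P P? with P? Fin.zero
  ... | yes _ = cong suc (countFin≡sumFin n _ _)
  ... | no _  = countFin≡sumFin n _ _

  countFin≤ : ∀ n (P : Fin n → Set a) (P? : ∀ j → Dec (P j)) → countFin n P P? ≤ n
  countFin≤ zero    P P? = z≤n
  countFin≤ (suc n) P P? with P? Fin.zero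
  ... | yes _ = s≤s (countFin≤ n _ _)
  ... | no _  = m≤n⇒m≤1+n (countFin≤ n _ _)

  countFin≡n⇒all : ∀ n (P : Fin n → Set a) (P? : ∀ j → Dec (P j)) → countFin n P P? ≡ n → ∀ j → P j
  countFin≡n⇒all (suc n) P P? eq j with P? Fin.zero | j
  ... | yes p  | Fin.zero  = p
  ... | yes _  | Fin.suc j = countFin≡n⇒all n _ _ (suc-injective eq) j
  ... | no _   | _         = ⊥-elim (1+n≰n (subst (_≤ n) eq (countFin≤ n _ _)))

  sumFin-cong : ∀ n {g h : Fin n → ℕ} → (∀ j → g j ≡ h j) → sumFin n g ≡ sumFin n h
  sumFin-cong zero    eq = refl
  sumFin-cong (suc n) eq = cong₂ _+_ (eq Fin.zero) (sumFin-cong n (λ j → eq (Fin.suc j)))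

  sumFin-zero : ∀ n {g : Fin n → ℕ} → (∀ j → g j ≡ 0) → sumFin n g ≡ 0
  sumFin-zero zero    eq = refl
  sumFin-zero (suc n) eq = cong₂ _+_ (eq Fin.zero) (sumFin-zero n (λ j → eq (Fin.suc j)))

  sumFin-delta : ∀ n {Q : Fin n → Set a} (Q? : ∀ j → Dec (Q j)) (c : ℕ) {j₀} → Q j₀ →
                 (∀ j j′ → Q j → Q j′ → j ≡ j′) → sumFin n (λ j → 𝟙 (Q? j) * c) ≡ c
  sumFin-delta (suc n) Q? c {Fin.zero} q₀ unique with Q? Fin.zero
  ... | yes _  = trans (cong₂ _+_ (+-identityʳ c) rest) (+-identityʳ c)
    where
    rest : sumFin n (λ j → 𝟙 (Q? (Fin.suc j)) * c) ≡ 0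
    rest = sumFin-zero n λ j → cong (_* c) (𝟙-no (Q? (Fin.suc j)) λ qj → case unique _ _ qj q₀ of λ ())
  ... | no ¬q₀ = ⊥-elim (¬q₀ q₀)
  sumFin-delta (suc n) Q? c {Fin.suc j₀} q₀ unique with Q? Fin.zero
  ... | yes qz = case unique _ _ q₀ qz of λ ()
  ... | no _   = sumFin-delta n (λ j → Q? (Fin.suc j)) c q₀ λ j j′ qj qj′ → Fin.suc-injective (unique _ _ qj qj′)

  sumFin-sum< : ∀ n m (g : Fin n → ℕ → ℕ) →
                sumFin n (λ j → sum< m (g j)) ≡ sum< m (λ k → sumFin n (λ j → g j k))
  sumFin-sum< zero    m g = sym (sum<-zero m (λ _ _ → refl))
  sumFin-sum< (suc n) m g = trans (cong (sum< m (g Fin.zero) +_) (sumFin-sum< n m (λ j → g (Fin.suc j))))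
                                  (sym (sum<-+ m (g Fin.zero) _))

  private
    2*≡+ : ∀ k → 2 * k ≡ k + k
    2*≡+ k = cong (k +_) (+-identityʳ k)

    reflect-< : ∀ {n} k → k ≤ n → n < 2 * (n ∸ k) → 2 * k < n
    reflect-< {n} k k≤n n<2m = subst (2 * k <_) (m+[n∸m]≡n k≤n) (subst (_< k + m) (sym (2*≡+ k)) (+-monoʳ-< k k<m))
      where
      m = n ∸ k
      k<m : k < m
      k<m = +-cancelʳ-< m k m (subst₂ _<_ (sym (m+[n∸m]≡n k≤n)) (2*≡+ m) n<2m)

    reflect-<⁻ : ∀ {n} k → k ≤ n → 2 * k < n → n < 2 * (n ∸ k)
    reflect-<⁻ {n} k k≤n 2k<n = subst₂ _<_ (m+[n∸m]≡n k≤n) (sym (2*≡+ m)) (+-monoˡ-< m k<m)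
      where
      m = n ∸ k
      k<m : k < m
      k<m = +-cancelˡ-< k k m (subst₂ _<_ (2*≡+ k) (sym (m+[n∸m]≡n k≤n)) 2k<n)

  sum<-palindrome : ∀ n (g : ℕ → ℕ) → g n ≡ 0 → (∀ k → k ≤ n → g (n ∸ k) ≡ g k) →
                    sum< n g ≡ 2 * sum< n (λ k → 𝟙 (2 * k <? n) * g k) + sum< n (λ k → 𝟙 (2 * k ≟ n) * g k)
  sum<-palindrome n g gn≡0 symmetric = begin
    sum< n g                              ≡⟨ sum<-cong n (λ k _ → trichotomy k) ⟩
    sum< n (λ k → (low k + mid k) + high k) ≡⟨ sum<-+ n _ high ⟩
    sum< n (λ k → low k + mid k) + sum< n high ≡⟨ cong₂ _+_ (sum<-+ n low mid) high≡low ⟩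
    (sum< n low + sum< n mid) + sum< n low ≡⟨ rearrange (sum< n low) (sum< n mid) ⟩
    2 * sum< n low + sum< n mid           ∎
    where
    open ≡-Reasoning
    low mid high : ℕ → ℕ
    low  k = 𝟙 (2 * k <? n) * g k
    mid  k = 𝟙 (2 * k ≟ n) * g k
    high k = 𝟙 (n <? 2 * k) * g k

    exactly-one : ∀ k → (𝟙 (2 * k <? n) + 𝟙 (2 * k ≟ n)) + 𝟙 (n <? 2 * k) ≡ 1
    exactly-one k with <-cmp (2 * k) n
    ... | tri< a ¬b ¬c = cong₂ _+_ (cong₂ _+_ (𝟙-yes (2 * k <? n) a) (𝟙-no (2 * k ≟ n) ¬b)) (𝟙-no (n <? 2 * k) ¬c)
    ... | tri≈ ¬a b ¬c = cong₂ _+_ (cong₂ _+_ (𝟙-no (2 * k <? n) ¬a) (𝟙-yes (2 * k ≟ n) b)) (𝟙-no (n <? 2 * k) ¬c)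
    ... | tri> ¬a ¬b c = cong₂ _+_ (cong₂ _+_ (𝟙-no (2 * k <? n) ¬a) (𝟙-no (2 * k ≟ n) ¬b)) (𝟙-yes (n <? 2 * k) c)

    trichotomy : ∀ k → g k ≡ (low k + mid k) + high k
    trichotomy k = begin
      g k                                   ≡⟨ *-identityˡ (g k) ⟨
      1 * g k                               ≡⟨ cong (_* g k) (exactly-one k) ⟨
      ((𝟙 (2 * k <? n) + 𝟙 (2 * k ≟ n)) + 𝟙 (n <? 2 * k)) * g k
                                            ≡⟨ *-distribʳ-+ (g k) (𝟙 (2 * k <? n) + 𝟙 (2 * k ≟ n)) (𝟙 (n <? 2 * k)) ⟩
      (𝟙 (2 * k <? n) + 𝟙 (2 * k ≟ n)) * g k + high k
                                            ≡⟨ cong (_+ high k) (*-distribʳ-+ (g k) (𝟙 (2 * k <? n)) (𝟙 (2 * k ≟ n))) ⟩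
      (low k + mid k) + high k              ∎

    high≡low : sum< n high ≡ sum< n low
    high≡low = begin
      sum< n high                    ≡⟨ sum<-reflect n high refl (trans (cong (𝟙 (n <? 2 * n) *_) gn≡0) (*-zeroʳ (𝟙 (n <? 2 * n)))) ⟩
      sum< n (λ k → high (n ∸ k))    ≡⟨ sum<-cong n (λ k k<n → cong₂ _*_
                                          (𝟙-cong (n <? 2 * (n ∸ k)) (2 * k <? n) (reflect-< k (<⇒≤ k<n)) (reflect-<⁻ k (<⇒≤ k<n)))
                                          (symmetric k (<⇒≤ k<n))) ⟩
      sum< n low                     ∎

    rearrange : ∀ a b → (a + b) + a ≡ 2 * a + b
    rearrange a b = trans (xy∙z≈xz∙y a b a) (cong (_+ b) (sym (2*≡+ a)))

  private
    half<n : ∀ k n → 2 * k ≡ n → 0 < n → k < n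
    half<n zero    n _    0<n = 0<n
    half<n (suc k) n 2k≡n _   = subst (suc k <_) (trans (cong (suc k +_) (sym (+-identityʳ (suc k)))) 2k≡n) (m<m+n (suc k) z<s)

  sum<-middle-odd : ∀ n (g : ℕ → ℕ) → ¬ 2 ∣ n → sum< n (λ k → 𝟙 (2 * k ≟ n) * g k) ≡ 0
  sum<-middle-odd n g n-odd = sum<-zero n λ k _ →
    cong (_* g k) (𝟙-no (2 * k ≟ n) λ 2k≡n → n-odd (divides k (trans (sym 2k≡n) (*-comm 2 k))))

  sum<-middle-even : ∀ n (g : ℕ → ℕ) {k} → 2 * k ≡ n → 0 < n → sum< n (λ r → 𝟙 (2 * r ≟ n) * g r) ≡ g k
  sum<-middle-even n g {k} 2k≡n 0<n = sum<-delta n (λ r → 2 * r ≟ n) g (half<n k n 2k≡n 0<n) 2k≡n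
    λ r r′ _ _ 2r≡n 2r′≡n → *-cancelˡ-≡ r r′ 2 (trans 2r≡n (sym 2r′≡n))

open IndicatorSums

module Parity where

  open import Data.Nat
  open import Data.Nat.Properties
  open import Relation.Binary.PropositionalEquality
  open import Data.Nat.Divisibility using (∣-refl; ∣m∣n⇒∣m+n; ∣m+n∣m⇒∣n; m∣m*n)

  private
    another-index : ∀ {m} j → 2 < m → Σ ℕ λ j′ → 1 ≤ j′ × j′ < m × j′ ≢ j
    another-index zero                2<m = 1 , s≤s z≤n , <-trans (n<1+n 1) 2<m , λ ()
    another-index (suc zero)          2<m = 2 , s≤s z≤n , 2<m , λ ()
    another-index (suc (suc j))       2<m = 1 , s≤s z≤n , <-trans (n<1+n 1) 2<m , λ ()

  -- φ j is the only odd value, so j cannot lie in the range 1 ≤ i < m on which φ is constant.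
  odd-index≡0 : ∀ {m j} (φ ψ : ℕ → ℕ) → 2 < m → j < m →
                (∀ i → i < m → φ i ≡ 2 * ψ i + 𝟙 (i ≟ j)) → (∀ i → 1 ≤ i → i < m → φ 1 ≡ φ i) → j ≡ 0
  odd-index≡0 {m} {zero}  φ ψ 2<m j<m φ≡ φ-constant = refl
  odd-index≡0 {m} {suc j} φ ψ 2<m j<m φ≡ φ-constant with another-index (suc j) 2<m
  ... | j′ , 1≤j′ , j′<m , j′≢j = ⊥-elim (even≢odd (ψ j′) (ψ (suc j)) (begin
    2 * ψ j′                         ≡⟨ +-identityʳ (2 * ψ j′) ⟨
    2 * ψ j′ + 0                     ≡⟨ cong (2 * ψ j′ +_) (𝟙-no (j′ ≟ suc j) j′≢j) ⟨
    2 * ψ j′ + 𝟙 (j′ ≟ suc j)        ≡⟨ φ≡ j′ j′<m ⟨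
    φ j′                             ≡⟨ φ-constant j′ 1≤j′ j′<m ⟨
    φ 1                              ≡⟨ φ-constant (suc j) (s≤s z≤n) j<m ⟩
    φ (suc j)                        ≡⟨ φ≡ (suc j) j<m ⟩
    2 * ψ (suc j) + 𝟙 (suc j ≟ suc j) ≡⟨ cong (2 * ψ (suc j) +_) (𝟙-yes (suc j ≟ suc j) refl) ⟩
    2 * ψ (suc j) + 1                ≡⟨ +-comm (2 * ψ (suc j)) 1 ⟩
    suc (2 * ψ (suc j))              ∎))
    where open ≡-Reasoning

  odd⇒≡1+2* : ∀ {m} → ¬ 2 ∣ m → Σ ℕ λ a → m ≡ suc (2 * a)
  odd⇒≡1+2* {zero}        m-odd = ⊥-elim (m-odd (divides 0 refl))
  odd⇒≡1+2* {suc zero}    _     = 0 , refl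
  odd⇒≡1+2* {suc (suc m)} m-odd with odd⇒≡1+2* {m} (λ 2∣m → m-odd (∣m∣n⇒∣m+n ∣-refl 2∣m))
  ... | a , m≡1+2a = suc a , cong (λ t → suc (suc t)) (trans m≡1+2a (sym (+-suc a (a + 0))))

  2∤2εs+ε : ∀ s {ε} → ¬ 2 ∣ ε → ¬ 2 ∣ s * (2 * ε) + ε
  2∤2εs+ε s {ε} ε-odd 2∣ = ε-odd (∣m+n∣m⇒∣n 2∣ (∣n⇒∣m*n s (m∣m*n ε)))

open Parity

module FiniteFieldProperties {c ℓ q} (F : FiniteField c ℓ q) where

  open FiniteField F
  open import Data.Nat.DivMod using (m≡m%n+[m/n]*n; m%n<n; [m+kn]%n≡m%n; m<n⇒m%n≡m; m∣n⇒o%n%m≡o%m)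
  open import Data.Nat.Tactic.RingSolver using (solve-∀)
  open import Algebra.Properties.Semiring.Exp semiring using (^-homo-*; ^-assocʳ; ^-congʳ; ^-congˡ)
  open import Algebra.Properties.Ring ring
    using (-1*x≈-x; [y-z]x≈yx-zx; x[y-z]≈xy-xz; ⁻¹-anti-homo‿-; -‿involutive; +-inverseʳ-unique; x∙y⁻¹≈ε⇒x≈y)
  module ≈-Reasoning = Relation.Binary.Reasoning.Setoid setoid

  countFin-enum≡countBelow : ∀ {p} (P : Carrier → Set p) (P? : ∀ x → Dec (P x)) →
    (∀ {x y} → x ≈ y → P x → P y) →
    (m : ℕ) (h : ℕ → Carrier) → (∀ r r′ → r < m → r′ < m → h r ≈ h r′ → r ≡ r′) →
    (∀ x → P x → Σ ℕ λ r → r < m × x ≈ h r) →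
    countFin q (λ j → P (enum j)) (λ j → P? (enum j)) ≡ countBelow m (λ r → P (h r)) (λ r → P? (h r))
  countFin-enum≡countBelow P P? P-resp m h h-injective h-onto = begin
    countFin q (λ j → P (enum j)) (λ j → P? (enum j))
      ≡⟨ countFin≡sumFin q _ _ ⟩
    sumFin q (λ j → 𝟙 (P? (enum j)))
      ≡⟨ sumFin-cong q (λ j → 𝟙≡sum (enum j)) ⟩
    sumFin q (λ j → sum< m (λ r → 𝟙 (enum j ≈? h r) Nat.* 𝟙 (P? (h r))))
      ≡⟨ sumFin-sum< q m _ ⟩
    sum< m (λ r → sumFin q (λ j → 𝟙 (enum j ≈? h r) Nat.* 𝟙 (P? (h r))))
      ≡⟨ sum<-cong m (λ r _ → enum-hits-once (h r) (𝟙 (P? (h r)))) ⟩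
    sum< m (λ r → 𝟙 (P? (h r)))
      ≡⟨ countBelow≡sum< m _ _ ⟨
    countBelow m (λ r → P (h r)) (λ r → P? (h r)) ∎
    where
    open ≡.≡-Reasoning

    enum-hits-once : ∀ y c → sumFin q (λ j → 𝟙 (enum j ≈? y) Nat.* c) ≡ c
    enum-hits-once y c = sumFin-delta q (λ j → enum j ≈? y) c (proj₂ (enum-sur y))
      λ j j′ jy j′y → enum-inj j j′ (trans jy (sym j′y))

    𝟙≡sum : ∀ x → 𝟙 (P? x) ≡ sum< m (λ r → 𝟙 (x ≈? h r) Nat.* 𝟙 (P? (h r)))
    𝟙≡sum x with P? x
    ... | yes px = let (r₀ , r₀<m , x≈hr₀) = h-onto x px in ≡.sym (≡.trans
          (sum<-delta m (λ r → x ≈? h r) (λ r → 𝟙 (P? (h r))) r₀<m x≈hr₀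
            λ r r′ r<m r′<m x≈hr x≈hr′ → h-injective r r′ r<m r′<m (trans (sym x≈hr) x≈hr′))
          (𝟙-yes (P? (h r₀)) (P-resp x≈hr₀ px)))
    ... | no ¬px = ≡.sym (sum<-zero m term≡0)
      where
      term≡0 : ∀ r → r < m → 𝟙 (x ≈? h r) Nat.* 𝟙 (P? (h r)) ≡ 0
      term≡0 r _ with x ≈? h r
      ... | yes x≈hr = ≡.trans (ℕₚ.+-identityʳ (𝟙 (P? (h r)))) (𝟙-no (P? (h r)) λ phr → ¬px (P-resp (sym x≈hr) phr))
      ... | no _     = ≡.refl

  invertible⇒≉0 : ∀ {x y} → x * y ≈ 1# → ¬ (x ≈ 0#)
  invertible⇒≉0 {x} {y} xy≈1 x≈0 = 0≉1 (begin
    0#     ≈⟨ zeroˡ y ⟨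
    0# * y ≈⟨ *-congʳ x≈0 ⟨
    x * y  ≈⟨ xy≈1 ⟩
    1#     ∎)
    where open ≈-Reasoning

  *-cancelˡ : ∀ {x y z} → ¬ (x ≈ 0#) → x * y ≈ x * z → y ≈ z
  *-cancelˡ {x} {y} {z} x≉0 xy≈xz = begin
    y             ≈⟨ *-identityˡ y ⟨
    1# * y        ≈⟨ *-congʳ x⁻¹x≈1 ⟨
    (x⁻¹ * x) * y ≈⟨ *-assoc x⁻¹ x y ⟩
    x⁻¹ * (x * y) ≈⟨ *-congˡ xy≈xz ⟩
    x⁻¹ * (x * z) ≈⟨ *-assoc x⁻¹ x z ⟨
    (x⁻¹ * x) * z ≈⟨ *-congʳ x⁻¹x≈1 ⟩
    1# * z        ≈⟨ *-identityˡ z ⟩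
    z             ∎
    where
    open ≈-Reasoning
    x⁻¹ = proj₁ (inverse x x≉0)
    x⁻¹x≈1 : x⁻¹ * x ≈ 1#
    x⁻¹x≈1 = trans (*-comm x⁻¹ x) (proj₂ (inverse x x≉0))

  x*y≈1⇒y≉1 : ∀ {x y} → x * y ≈ 1# → ¬ (x ≈ 1#) → ¬ (y ≈ 1#)
  x*y≈1⇒y≉1 {x} {y} xy≈1 x≉1 y≈1 = x≉1 (trans (sym (*-identityʳ x)) (trans (*-congˡ (sym y≈1)) xy≈1))

  x*y≈1⇒y-1≈-1*[x-1]*y : ∀ {x y} → x * y ≈ 1# → y - 1# ≈ (- 1# * (x - 1#)) * y
  x*y≈1⇒y-1≈-1*[x-1]*y {x} {y} xy≈1 = begin
    y - 1#                ≈⟨ +-cong (*-identityˡ y) (-‿cong xy≈1) ⟨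
    1# * y - x * y        ≈⟨ [y-z]x≈yx-zx y 1# x ⟨
    (1# - x) * y          ≈⟨ *-congʳ (⁻¹-anti-homo‿- x 1#) ⟨
    - (x - 1#) * y        ≈⟨ *-congʳ (-1*x≈-x (x - 1#)) ⟨
    (- 1# * (x - 1#)) * y ∎
    where open ≈-Reasoning

  -1*-1≈1 : - 1# * - 1# ≈ 1#
  -1*-1≈1 = trans (-1*x≈-x (- 1#)) (-‿involutive 1#)

  1^≈1 : ∀ t → 1# ^ t ≈ 1#
  1^≈1 zero    = refl
  1^≈1 (suc t) = trans (*-identityˡ (1# ^ t)) (1^≈1 t)

  -1^[1+2m]≈-1 : ∀ m → (- 1#) ^ suc (2 Nat.* m) ≈ - 1#
  -1^[1+2m]≈-1 m = begin
    - 1# * (- 1#) ^ (2 Nat.* m) ≈⟨ *-congˡ (^-assocʳ (- 1#) 2 m) ⟨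
    - 1# * ((- 1#) ^ 2) ^ m     ≈⟨ *-congˡ (^-congˡ m (trans (*-congˡ (*-identityʳ (- 1#))) -1*-1≈1)) ⟩
    - 1# * 1# ^ m               ≈⟨ *-congˡ (1^≈1 m) ⟩
    - 1# * 1#                   ≈⟨ *-identityʳ (- 1#) ⟩
    - 1#                        ∎
    where open ≈-Reasoning

  module Powers {n : ℕ} (q≡1+n : q ≡ suc n) {{n≢0 : NonZero n}} where

    α^n≈1 : α ^ n ≈ 1#
    α^n≈1 = trans (^-congʳ α (≡.cong (_∸ 1) (≡.sym q≡1+n))) α-order

    α^[a+n*t]≈α^a : ∀ a t → α ^ (a Nat.+ n Nat.* t) ≈ α ^ a
    α^[a+n*t]≈α^a a t = begin
      α ^ (a Nat.+ n Nat.* t) ≈⟨ ^-homo-* α a (n Nat.* t) ⟩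
      α ^ a * α ^ (n Nat.* t) ≈⟨ *-congˡ (^-assocʳ α n t) ⟨
      α ^ a * (α ^ n) ^ t     ≈⟨ *-congˡ (trans (^-congˡ t α^n≈1) (1^≈1 t)) ⟩
      α ^ a * 1#              ≈⟨ *-identityʳ (α ^ a) ⟩
      α ^ a                   ∎
      where open ≈-Reasoning

    α^≈α^[%n] : ∀ a → α ^ a ≈ α ^ (a % n)
    α^≈α^[%n] a = trans (^-congʳ α a≡) (α^[a+n*t]≈α^a (a % n) (a / n))
      where
      a≡ : a ≡ a % n Nat.+ n Nat.* (a / n)
      a≡ = ≡.trans (m≡m%n+[m/n]*n a n) (≡.cong (a % n Nat.+_) (ℕₚ.*-comm (a / n) n))

    α^≉0 : ∀ a → ¬ (α ^ a ≈ 0#)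
    α^≉0 a = invertible⇒≉0 (begin
      α ^ a * α ^ (Nat.pred n Nat.* a) ≈⟨ ^-homo-* α a (Nat.pred n Nat.* a) ⟨
      α ^ (suc (Nat.pred n) Nat.* a)    ≈⟨ ^-congʳ α (≡.trans (≡.cong (Nat._* a) (ℕₚ.suc-pred n)) (ℕₚ.+-identityˡ (n Nat.* a))) ⟩
      α ^ (0 Nat.+ n Nat.* a)           ≈⟨ α^[a+n*t]≈α^a 0 a ⟩
      1#                                ∎)
      where open ≈-Reasoning

    α^≉1 : ∀ {k} → 0 < k → k < n → ¬ (α ^ k ≈ 1#)
    α^≉1 {k} 0<k k<n = α-prim k 0<k (≡.subst (k <_) (≡.cong (_∸ 1) (≡.sym q≡1+n)) k<n)

    private
      α^-injective-≤ : ∀ {a b} → a ≤ b → b < n → α ^ a ≈ α ^ b → a ≡ b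
      α^-injective-≤ {a} {b} a≤b b<n α^a≈α^b with b ∸ a Nat.≟ 0
      ... | yes b∸a≡0 = ℕₚ.≤-antisym a≤b (ℕₚ.m∸n≡0⇒m≤n b∸a≡0)
      ... | no b∸a≢0  = ⊥-elim (α^≉1 (ℕₚ.n≢0⇒n>0 b∸a≢0) (ℕₚ.≤-<-trans (ℕₚ.m∸n≤m b a) b<n) (sym 1≈α^[b∸a]))
        where
        1≈α^[b∸a] : 1# ≈ α ^ (b ∸ a)
        1≈α^[b∸a] = *-cancelˡ (α^≉0 a) (begin
          α ^ a * 1#            ≈⟨ *-identityʳ (α ^ a) ⟩
          α ^ a                 ≈⟨ α^a≈α^b ⟩
          α ^ b                 ≈⟨ ^-congʳ α (ℕₚ.m+[n∸m]≡n a≤b) ⟨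
          α ^ (a Nat.+ (b ∸ a)) ≈⟨ ^-homo-* α a (b ∸ a) ⟩
          α ^ a * α ^ (b ∸ a)   ∎)
          where open ≈-Reasoning

    α^-injective : ∀ {a b} → a < n → b < n → α ^ a ≈ α ^ b → a ≡ b
    α^-injective {a} {b} a<n b<n α^a≈α^b with ℕₚ.≤-total a b
    ... | inj₁ a≤b = α^-injective-≤ a≤b b<n α^a≈α^b
    ... | inj₂ b≤a = ≡.sym (α^-injective-≤ b≤a a<n (sym α^a≈α^b))

    α^≈α^⇒%≡ : ∀ {a b} → α ^ a ≈ α ^ b → a % n ≡ b % n
    α^≈α^⇒%≡ {a} {b} α^a≈α^b = α^-injective (m%n<n a n) (m%n<n b n)
      (trans (sym (α^≈α^[%n] a)) (trans α^a≈α^b (α^≈α^[%n] b)))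

    IsPower : Carrier → Set ℓ
    IsPower x = Σ ℕ λ k → k < n × x ≈ α ^ k

    private
      ZeroOrPower : Carrier → Set ℓ
      ZeroOrPower y = y ≈ 0# ⊎ IsPower y

      ZeroOrPower? : ∀ y → Dec (ZeroOrPower y)
      ZeroOrPower? y = (y ≈? 0#) ⊎-dec ∃<? n (λ k → y ≈ α ^ k) (λ k → y ≈? (α ^ k))

    -- 0 and the n distinct powers α ^ k (k < n) already account for all q = 1 + n elements.
    enum-zero-or-power : ∀ j → ZeroOrPower (enum j)
    enum-zero-or-power = countFin≡n⇒all q _ _ (≡.trans
      (countFin-enum≡countBelow ZeroOrPower ZeroOrPower? resp q h h-injective h-onto)
      (countBelow-all q _ _ h-hits))
      where
      resp : ∀ {y z} → y ≈ z → ZeroOrPower y → ZeroOrPower z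
      resp y≈z (inj₁ y≈0)               = inj₁ (trans (sym y≈z) y≈0)
      resp y≈z (inj₂ (k , k<n , y≈α^k)) = inj₂ (k , k<n , trans (sym y≈z) y≈α^k)

      h : ℕ → Carrier
      h zero    = 0#
      h (suc k) = α ^ k

      <q⇒≤n : ∀ {r} → r < q → r ≤ n
      <q⇒≤n r<q = ℕₚ.≤-pred (≡.subst (_ <_) q≡1+n r<q)

      h-injective : ∀ r r′ → r < q → r′ < q → h r ≈ h r′ → r ≡ r′
      h-injective zero    zero     _   _    _  = ≡.refl
      h-injective zero    (suc k′) _   _    eq = ⊥-elim (α^≉0 k′ (sym eq))
      h-injective (suc k) zero     _   _    eq = ⊥-elim (α^≉0 k eq)
      h-injective (suc k) (suc k′) k<q k′<q eq = ≡.cong suc (α^-injective (<q⇒≤n k<q) (<q⇒≤n k′<q) eq)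

      h-onto : ∀ y → ZeroOrPower y → Σ ℕ λ r → r < q × y ≈ h r
      h-onto y (inj₁ y≈0)               = 0 , ≡.subst (0 <_) (≡.sym q≡1+n) (Nat.s≤s Nat.z≤n) , y≈0
      h-onto y (inj₂ (k , k<n , y≈α^k)) = suc k , ≡.subst (suc k <_) (≡.sym q≡1+n) (Nat.s≤s k<n) , y≈α^k

      h-hits : ∀ r → r < q → ZeroOrPower (h r)
      h-hits zero    _   = inj₁ refl
      h-hits (suc k) k<q = inj₂ (k , <q⇒≤n k<q , refl)

    nonzero⇒power : ∀ {x} → ¬ (x ≈ 0#) → IsPower x
    nonzero⇒power {x} x≉0 with enum-sur x
    ... | j , enum-j≈x with enum-zero-or-power j
    ...   | inj₁ enum-j≈0 = ⊥-elim (x≉0 (trans (sym enum-j≈x) enum-j≈0))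
    ...   | inj₂ (k , k<n , enum-j≈α^k) = k , k<n , trans (sym enum-j≈x) enum-j≈α^k

    α^h≉1 : ∀ h → h Nat.+ h ≡ n → ¬ (α ^ h ≈ 1#)
    α^h≉1 h h+h≡n = α^≉1 0<h (≡.subst (h <_) h+h≡n (ℕₚ.m<m+n h 0<h))
      where
      0<h : 0 < h
      0<h = ℕₚ.n≢0⇒n>0 λ h≡0 → ℕₚ.<-irrefl (≡.trans (≡.cong (λ t → t Nat.+ t) (≡.sym h≡0)) h+h≡n) (Nat.>-nonZero⁻¹ n)

    α^h≈-1 : ∀ h → h Nat.+ h ≡ n → α ^ h ≈ - 1#
    α^h≈-1 h h+h≡n = *-cancelˡ z-1≉0 (begin
      (z - 1#) * z    ≈⟨ [y-z]x≈yx-zx z z 1# ⟩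
      z * z - 1# * z  ≈⟨ +-cong z*z≈1 (-‿cong (*-identityˡ z)) ⟩
      1# - z          ≈⟨ ⁻¹-anti-homo‿- z 1# ⟨
      - (z - 1#)      ≈⟨ -1*x≈-x (z - 1#) ⟨
      - 1# * (z - 1#) ≈⟨ *-comm (- 1#) (z - 1#) ⟩
      (z - 1#) * - 1# ∎)
      where
      open ≈-Reasoning
      z = α ^ h
      z*z≈1 : z * z ≈ 1#
      z*z≈1 = trans (sym (^-homo-* α h h)) (trans (^-congʳ α h+h≡n) α^n≈1)
      z-1≉0 : ¬ (z - 1# ≈ 0#)
      z-1≉0 z-1≈0 = α^h≉1 h h+h≡n (x∙y⁻¹≈ε⇒x≈y z 1# z-1≈0)

    open Cyclotomy F using (InC)

    module Classes {d s : ℕ} (d*s≡n : d Nat.* s ≡ n) where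

      private instance
        d*s≢0 : NonZero (d Nat.* s)
        d*s≢0 = ≡.subst NonZero (≡.sym d*s≡n) n≢0
        d≢0 : NonZero d
        d≢0 = ℕₚ.m*n≢0⇒m≢0 d
        s≢0 : NonZero s
        s≢0 = ℕₚ.m*n≢0⇒n≢0 d

      power⇒InC : ∀ {i m x} → x ≈ α ^ (i Nat.+ d Nat.* m) → InC d i x
      power⇒InC {i} {m} {x} x≈α^[i+dm] = m % s , m%s<q , (begin
        x                                              ≈⟨ x≈α^[i+dm] ⟩
        α ^ (i Nat.+ d Nat.* m)                        ≈⟨ ^-congʳ α exponent ⟩
        α ^ ((i Nat.+ d Nat.* (m % s)) Nat.+ n Nat.* (m / s)) ≈⟨ α^[a+n*t]≈α^a (i Nat.+ d Nat.* (m % s)) (m / s) ⟩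
        α ^ (i Nat.+ d Nat.* (m % s))                  ≈⟨ ^-homo-* α i (d Nat.* (m % s)) ⟩
        α ^ i * α ^ (d Nat.* (m % s))                  ∎)
        where
        open ≈-Reasoning
        m%s<q : m % s < q
        m%s<q = ℕₚ.<-≤-trans (m%n<n m s) (ℕₚ.≤-trans (≡.subst (s ≤_) d*s≡n (ℕₚ.m≤n*m s d))
                  (≡.subst (n ≤_) (≡.sym q≡1+n) (ℕₚ.n≤1+n n)))
        exponent : i Nat.+ d Nat.* m ≡ (i Nat.+ d Nat.* (m % s)) Nat.+ n Nat.* (m / s)
        exponent = ≡.trans (≡.cong (λ t → i Nat.+ d Nat.* t) (m≡m%n+[m/n]*n m s))
          (≡.trans (regroup i d (m % s) (m / s) s) (≡.cong (λ t → (i Nat.+ d Nat.* (m % s)) Nat.+ t Nat.* (m / s)) d*s≡n))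
          where
          regroup : ∀ i d a b s → i Nat.+ d Nat.* (a Nat.+ b Nat.* s) ≡ (i Nat.+ d Nat.* a) Nat.+ (d Nat.* s) Nat.* b
          regroup = solve-∀

      InC⇒power : ∀ {i x} → InC d i x → Σ ℕ λ m → x ≈ α ^ (i Nat.+ d Nat.* m)
      InC⇒power {i} (m , _ , x≈α^i*α^dm) = m , trans x≈α^i*α^dm (sym (^-homo-* α i (d Nat.* m)))

      InC-resp : ∀ {i x y} → x ≈ y → InC d i x → InC d i y
      InC-resp x≈y (m , m<q , x≈) = m , m<q , trans (sym x≈y) x≈

      InC-+d : ∀ {i x} → InC d (i Nat.+ d) x → InC d i x
      InC-+d {i} x∈C with InC⇒power {i = i Nat.+ d} x∈C
      ... | m , x≈α^[i+d+dm] = power⇒InC {i = i} {m = 1 Nat.+ m} (trans x≈α^[i+d+dm] (^-congʳ α (regroup i d m)))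
        where
        regroup : ∀ i d m → (i Nat.+ d) Nat.+ d Nat.* m ≡ i Nat.+ d Nat.* (1 Nat.+ m)
        regroup = solve-∀

      InC-unique : ∀ {i j x} → i < d → j < d → InC d i x → InC d j x → i ≡ j
      InC-unique {i} {j} i<d j<d x∈Cᵢ x∈Cⱼ with InC⇒power {i = i} x∈Cᵢ | InC⇒power {i = j} x∈Cⱼ
      ... | k , x≈α^[i+dk] | k′ , x≈α^[j+dk′] = begin
        i                                      ≡⟨ residue i<d k ⟨
        (i Nat.+ d Nat.* k) % d                ≡⟨ m∣n⇒o%n%m≡o%m d n _ d∣n ⟨
        ((i Nat.+ d Nat.* k) % n) % d          ≡⟨ ≡.cong (_% d) (α^≈α^⇒%≡ (trans (sym x≈α^[i+dk]) x≈α^[j+dk′])) ⟩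
        ((j Nat.+ d Nat.* k′) % n) % d         ≡⟨ m∣n⇒o%n%m≡o%m d n _ d∣n ⟩
        (j Nat.+ d Nat.* k′) % d               ≡⟨ residue j<d k′ ⟩
        j                                      ∎
        where
        open ≡.≡-Reasoning
        d∣n : d ∣ n
        d∣n = divides s (≡.trans (≡.sym d*s≡n) (ℕₚ.*-comm d s))
        residue : ∀ {r} → r < d → ∀ t → (r Nat.+ d Nat.* t) % d ≡ r
        residue {r} r<d t = ≡.trans (≡.cong (λ u → (r Nat.+ u) % d) (ℕₚ.*-comm d t))
                              (≡.trans ([m+kn]%n≡m%n r t d) (m<n⇒m%n≡m r<d))

      nonzero⇒InC : ∀ {x} → ¬ (x ≈ 0#) → Σ ℕ λ j → j < d × InC d j x
      nonzero⇒InC x≉0 with nonzero⇒power x≉0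
      ... | k , _ , x≈α^k = k % d , m%n<n k d , power⇒InC {i = k % d} {m = k / d} (trans x≈α^k (^-congʳ α k≡))
        where
        k≡ : k ≡ k % d Nat.+ d Nat.* (k / d)
        k≡ = ≡.trans (m≡m%n+[m/n]*n k d) (≡.cong (k % d Nat.+_) (ℕₚ.*-comm (k / d) d))

    -- ι = α ^ t satisfies ι ² = - 1, so (1 + ι) ² ι = (1 + ι) (ι - 1) = - 2.
    -1-1≈α^[u+u+t] : ∀ {t} → (t Nat.+ t) Nat.+ (t Nat.+ t) ≡ n → Σ ℕ λ u → - 1# - 1# ≈ α ^ ((u Nat.+ u) Nat.+ t)
    -1-1≈α^[u+u+t] {t} 4t≡n = u , sym (begin
      α ^ ((u Nat.+ u) Nat.+ t)   ≈⟨ ^-homo-* α (u Nat.+ u) t ⟩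
      α ^ (u Nat.+ u) * ι         ≈⟨ *-congʳ (^-homo-* α u u) ⟩
      (α ^ u * α ^ u) * ι         ≈⟨ *-congʳ (*-cong 1+ι≈α^u 1+ι≈α^u) ⟨
      ((1# + ι) * (1# + ι)) * ι   ≈⟨ *-assoc (1# + ι) (1# + ι) ι ⟩
      (1# + ι) * ((1# + ι) * ι)   ≈⟨ *-congˡ (trans (distribʳ ι 1# ι) (+-cong (*-identityˡ ι) ι*ι≈-1)) ⟩
      (1# + ι) * (ι - 1#)         ≈⟨ distribʳ (ι - 1#) 1# ι ⟩
      1# * (ι - 1#) + ι * (ι - 1#) ≈⟨ +-cong (*-identityˡ (ι - 1#)) (x[y-z]≈xy-xz ι ι 1#) ⟩
      (ι - 1#) + (ι * ι - ι * 1#) ≈⟨ +-congˡ (+-cong ι*ι≈-1 (-‿cong (*-identityʳ ι))) ⟩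
      (ι - 1#) + (- 1# - ι)       ≈⟨ +-comm (ι - 1#) (- 1# - ι) ⟩
      (- 1# - ι) + (ι - 1#)       ≈⟨ +-assoc (- 1#) (- ι) (ι - 1#) ⟩
      - 1# + (- ι + (ι - 1#))     ≈⟨ +-congˡ (+-assoc (- ι) ι (- 1#)) ⟨
      - 1# + ((- ι + ι) - 1#)     ≈⟨ +-congˡ (trans (+-congʳ (-‿inverseˡ ι)) (+-identityˡ (- 1#))) ⟩
      - 1# - 1#                   ∎)
      where
      open ≈-Reasoning
      ι = α ^ t
      ι*ι≈-1 : ι * ι ≈ - 1#
      ι*ι≈-1 = trans (sym (^-homo-* α t t)) (α^h≈-1 (t Nat.+ t) 4t≡n)
      1+ι≉0 : ¬ (1# + ι ≈ 0#)
      1+ι≉0 1+ι≈0 = α^h≉1 (t Nat.+ t) 4t≡n (begin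
        α ^ (t Nat.+ t) ≈⟨ ^-homo-* α t t ⟩
        ι * ι           ≈⟨ *-cong ι≈-1 ι≈-1 ⟩
        - 1# * - 1#     ≈⟨ -1*-1≈1 ⟩
        1#              ∎)
        where
        ι≈-1 : ι ≈ - 1#
        ι≈-1 = +-inverseʳ-unique 1# ι 1+ι≈0
      u = proj₁ (nonzero⇒power 1+ι≉0)
      1+ι≈α^u : 1# + ι ≈ α ^ u
      1+ι≈α^u = proj₂ (proj₂ (nonzero⇒power 1+ι≉0))

module CyclotomicNumbers {c ℓ q} (F : FiniteField c ℓ q) {e f ε ρ : ℕ}
    (q≡1+ef : q ≡ suc (e Nat.* f)) (ε*ρ≡e*f : ε Nat.* ρ ≡ e Nat.* f) (ε∣e : ε ∣ e)
    {{ef≢0 : NonZero (e Nat.* f)}} where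

  open FiniteField F
  open Cyclotomy F
  open FiniteFieldProperties F
  open Powers q≡1+ef
  module Cᵉ = Classes {e} {f} ≡.refl
  module Cᵋ = Classes {ε} {ρ} ε*ρ≡e*f
  open import Algebra.Properties.Semiring.Exp semiring using (^-homo-*; ^-congʳ; ^-congˡ; ^-assocʳ)
  open import Algebra.Properties.Ring ring using (x∙y⁻¹≈ε⇒x≈y)
  open import Data.Nat.Tactic.RingSolver using (solve-∀)

  private
    n = e Nat.* f
    instance
      e≢0 : NonZero e
      e≢0 = ℕₚ.m*n≢0⇒m≢0 e
      f≢0 : NonZero f
      f≢0 = ℕₚ.m*n≢0⇒n≢0 e

  χ : ℕ → ℕ → ℕ
  χ i r = 𝟙 (InΦ? e ε i (α ^ (r Nat.* e)))

  InΦ-resp : ∀ {i x y} → x ≈ y → InΦ e ε i x → InΦ e ε i y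
  InΦ-resp {i} x≈y (x∈C₀ᵉ , x≉1 , x-1∈Cᵢᵋ) =
    Cᵉ.InC-resp {i = 0} x≈y x∈C₀ᵉ , (λ y≈1 → x≉1 (trans x≈y y≈1)) , Cᵋ.InC-resp {i = i} (+-congʳ x≈y) x-1∈Cᵢᵋ

  InΦ-+ε : ∀ {i x} → InΦ e ε (i Nat.+ ε) x → InΦ e ε i x
  InΦ-+ε {i} (x∈C₀ᵉ , x≉1 , x-1∈C) = x∈C₀ᵉ , x≉1 , Cᵋ.InC-+d {i = i} x-1∈C

  1∉Φ : ∀ {i x} → x ≈ 1# → ¬ InΦ e ε i x
  1∉Φ x≈1 (_ , x≉1 , _) = x≉1 x≈1

  α^[fe]≈1 : α ^ (f Nat.* e) ≈ 1#
  α^[fe]≈1 = trans (^-congʳ α (ℕₚ.*-comm f e)) α^n≈1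

  Φ⇒0<r : ∀ {i r} → InΦ e ε i (α ^ (r Nat.* e)) → 0 < r
  Φ⇒0<r {i} {zero} x∈Φ = ⊥-elim (1∉Φ {i} refl x∈Φ)
  Φ⇒0<r {i} {suc r} _   = Nat.s≤s Nat.z≤n

  χ-f : ∀ i → χ i f ≡ 0
  χ-f i = 𝟙-no (InΦ? e ε i (α ^ (f Nat.* e))) (1∉Φ {i} α^[fe]≈1)

  α^[re]-injective : ∀ r r′ → r < f → r′ < f → α ^ (r Nat.* e) ≈ α ^ (r′ Nat.* e) → r ≡ r′
  α^[re]-injective r r′ r<f r′<f eq = ℕₚ.*-cancelʳ-≡ r r′ e (α^-injective (re<n r<f) (re<n r′<f) eq)
    where
    re<n : ∀ {r} → r < f → r Nat.* e < n
    re<n {r} r<f = ≡.subst (r Nat.* e <_) (ℕₚ.*-comm f e) (ℕₚ.*-monoˡ-< e r<f)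

  Φ⊆α^[re] : ∀ {i} x → InΦ e ε i x → Σ ℕ λ r → r < f × x ≈ α ^ (r Nat.* e)
  Φ⊆α^[re] x (x∈C₀ᵉ , _) with Cᵉ.InC⇒power {i = 0} x∈C₀ᵉ
  ... | m , x≈α^em = m % f , Data.Nat.DivMod.m%n<n m f ,
        trans x≈α^em (trans (^-congʳ α exponent) (α^[a+n*t]≈α^a ((m % f) Nat.* e) (m / f)))
    where
    exponent : e Nat.* m ≡ (m % f) Nat.* e Nat.+ n Nat.* (m / f)
    exponent = ≡.trans (≡.cong (e Nat.*_) (Data.Nat.DivMod.m≡m%n+[m/n]*n m f)) (regroup e (m % f) (m / f) f)
      where
      regroup : ∀ e a b f → e Nat.* (a Nat.+ b Nat.* f) ≡ a Nat.* e Nat.+ (e Nat.* f) Nat.* b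
      regroup = solve-∀

  φ≡sum<χ : ∀ i → φ e ε i ≡ sum< f (χ i)
  φ≡sum<χ i = ≡.trans
    (countFin-enum≡countBelow (InΦ e ε i) (InΦ? e ε i) (InΦ-resp {i}) f (λ r → α ^ (r Nat.* e)) α^[re]-injective (Φ⊆α^[re] {i}))
    (countBelow≡sum< f (λ r → InΦ e ε i (α ^ (r Nat.* e))) (λ r → InΦ? e ε i (α ^ (r Nat.* e))))

  Φ-reflect : ∀ {a i r} → InC ε a (- 1#) → r ≤ f → InΦ e ε i (α ^ (r Nat.* e)) →
              InΦ e ε (i Nat.+ a) (α ^ ((f ∸ r) Nat.* e))
  Φ-reflect {a} {i} {r} -1∈Cₐ r≤f (_ , x≉1 , x-1∈Cᵢ)
    with Cᵋ.InC⇒power {i = a} -1∈Cₐ | Cᵋ.InC⇒power {i = i} x-1∈Cᵢ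
  ... | b , -1≈α^[a+εb] | k , x-1≈α^[i+εk] =
      Cᵉ.power⇒InC {i = 0} {m = f ∸ r} (^-congʳ α (ℕₚ.*-comm (f ∸ r) e))
    , x*y≈1⇒y≉1 x*y≈1 x≉1
    , Cᵋ.power⇒InC {i = i Nat.+ a} {m = (b Nat.+ k) Nat.+ (f ∸ r) Nat.* e′} (begin
        y - 1#                                ≈⟨ x*y≈1⇒y-1≈-1*[x-1]*y x*y≈1 ⟩
        (- 1# * (x - 1#)) * y                 ≈⟨ *-congʳ (*-cong -1≈α^[a+εb] x-1≈α^[i+εk]) ⟩
        (α ^ (a Nat.+ ε Nat.* b) * α ^ (i Nat.+ ε Nat.* k)) * y
                                              ≈⟨ *-congʳ (^-homo-* α (a Nat.+ ε Nat.* b) (i Nat.+ ε Nat.* k)) ⟨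
        α ^ ((a Nat.+ ε Nat.* b) Nat.+ (i Nat.+ ε Nat.* k)) * y
                                              ≈⟨ ^-homo-* α ((a Nat.+ ε Nat.* b) Nat.+ (i Nat.+ ε Nat.* k)) ((f ∸ r) Nat.* e) ⟨
        α ^ (((a Nat.+ ε Nat.* b) Nat.+ (i Nat.+ ε Nat.* k)) Nat.+ (f ∸ r) Nat.* e)
                                              ≈⟨ ^-congʳ α exponent ⟩
        α ^ ((i Nat.+ a) Nat.+ ε Nat.* ((b Nat.+ k) Nat.+ (f ∸ r) Nat.* e′)) ∎)
    where
    open ≈-Reasoning
    x y : Carrier
    x = α ^ (r Nat.* e)
    y = α ^ ((f ∸ r) Nat.* e)
    x*y≈1 : x * y ≈ 1#
    x*y≈1 = trans (sym (^-homo-* α (r Nat.* e) ((f ∸ r) Nat.* e))) (trans (^-congʳ α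
              (≡.trans (≡.sym (ℕₚ.*-distribʳ-+ e r (f ∸ r))) (≡.cong (Nat._* e) (ℕₚ.m+[n∸m]≡n r≤f)))) α^[fe]≈1)
    e′ = quotient ε∣e
    exponent : ((a Nat.+ ε Nat.* b) Nat.+ (i Nat.+ ε Nat.* k)) Nat.+ (f ∸ r) Nat.* e
             ≡ (i Nat.+ a) Nat.+ ε Nat.* ((b Nat.+ k) Nat.+ (f ∸ r) Nat.* e′)
    exponent = ≡.trans (≡.cong (λ t → ((a Nat.+ ε Nat.* b) Nat.+ (i Nat.+ ε Nat.* k)) Nat.+ (f ∸ r) Nat.* t) (m∣n⇒n≡quotient*m ε∣e))
                       (regroup a b i k (f ∸ r) e′ ε)
      where
      regroup : ∀ a b i k t e′ ε → ((a Nat.+ ε Nat.* b) Nat.+ (i Nat.+ ε Nat.* k)) Nat.+ t Nat.* (e′ Nat.* ε)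
                                 ≡ (i Nat.+ a) Nat.+ ε Nat.* ((b Nat.+ k) Nat.+ t Nat.* e′)
      regroup = solve-∀

  χ-reflect : ∀ {a} i → InC ε a (- 1#) → (∀ {x} → InΦ e ε ((i Nat.+ a) Nat.+ a) x → InΦ e ε i x) →
              ∀ r → r ≤ f → χ i (f ∸ r) ≡ χ (i Nat.+ a) r
  χ-reflect {a} i -1∈Cₐ back r r≤f = 𝟙-cong (InΦ? e ε i _) (InΦ? e ε (i Nat.+ a) _) to from
    where
    to : InΦ e ε i (α ^ ((f ∸ r) Nat.* e)) → InΦ e ε (i Nat.+ a) (α ^ (r Nat.* e))
    to x∈Φᵢ = ≡.subst (λ t → InΦ e ε (i Nat.+ a) (α ^ (t Nat.* e))) (ℕₚ.m∸[m∸n]≡n r≤f)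
                (Φ-reflect {a} {i} -1∈Cₐ (ℕₚ.m∸n≤m f r) x∈Φᵢ)
    from : InΦ e ε (i Nat.+ a) (α ^ (r Nat.* e)) → InΦ e ε i (α ^ ((f ∸ r) Nat.* e))
    from x∈Φᵢ₊ₐ = back (Φ-reflect {a} {i Nat.+ a} -1∈Cₐ r≤f x∈Φᵢ₊ₐ)

  ψ≡lower-sum : ∀ i → ψ e f ε i ≡ sum< f (λ r → 𝟙 (2 Nat.* r ℕₚ.<? f) Nat.* χ i r)
  ψ≡lower-sum i = ≡.trans (countBelow≡sum< f (InΨ e f ε i) (InΨ? e f ε i)) (sum<-cong f λ r _ →
    ≡.trans (𝟙-cong (InΨ? e f ε i r) ((2 Nat.* r ℕₚ.<? f) ×-dec InΦ? e ε i (α ^ (r Nat.* e)))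
                    (λ (lift (_ , 2r<f) , x∈Φ) → 2r<f , x∈Φ) (λ (2r<f , x∈Φ) → lift (Φ⇒0<r {i} x∈Φ , 2r<f) , x∈Φ))
            (𝟙-× (2 Nat.* r ℕₚ.<? f) (InΦ? e ε i (α ^ (r Nat.* e)))))

  φ≡2ψ+middle : InC ε 0 (- 1#) → ∀ i →
                φ e ε i ≡ 2 Nat.* ψ e f ε i Nat.+ sum< f (λ r → 𝟙 (2 Nat.* r Nat.≟ f) Nat.* χ i r)
  φ≡2ψ+middle -1∈C₀ i = ≡.trans (φ≡sum<χ i) (≡.trans (sum<-palindrome f (χ i) (χ-f i) symmetric)
    (≡.cong (λ t → 2 Nat.* t Nat.+ sum< f (λ r → 𝟙 (2 Nat.* r Nat.≟ f) Nat.* χ i r)) (≡.sym (ψ≡lower-sum i))))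
    where
    i+0+0≡i : (i Nat.+ 0) Nat.+ 0 ≡ i
    i+0+0≡i = ≡.trans (ℕₚ.+-identityʳ (i Nat.+ 0)) (ℕₚ.+-identityʳ i)
    symmetric : ∀ r → r ≤ f → χ i (f ∸ r) ≡ χ i r
    symmetric r r≤f = ≡.trans (χ-reflect {0} i -1∈C₀ (λ {x} → ≡.subst (λ t → InΦ e ε t x) i+0+0≡i) r r≤f)
                              (≡.cong (λ t → χ t r) (ℕₚ.+-identityʳ i))

  φ≡2ψ : InC ε 0 (- 1#) → ¬ 2 ∣ f → ∀ i → φ e ε i ≡ 2 Nat.* ψ e f ε i
  φ≡2ψ -1∈C₀ f-odd i = ≡.trans (φ≡2ψ+middle -1∈C₀ i)
    (≡.trans (≡.cong (2 Nat.* ψ e f ε i Nat.+_) (sum<-middle-odd f (χ i) f-odd)) (ℕₚ.+-identityʳ (2 Nat.* ψ e f ε i)))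

  ke+ke≡n : ∀ {k} → 2 Nat.* k ≡ f → k Nat.* e Nat.+ k Nat.* e ≡ n
  ke+ke≡n {k} 2k≡f = ≡.trans (regroup k e) (≡.cong (e Nat.*_) 2k≡f)
    where
    regroup : ∀ k e → k Nat.* e Nat.+ k Nat.* e ≡ e Nat.* (2 Nat.* k)
    regroup = solve-∀

  -1-1≉0 : ∀ {k} → 2 Nat.* k ≡ f → ¬ (- 1# - 1# ≈ 0#)
  -1-1≉0 {k} 2k≡f -1-1≈0 = α^h≉1 (k Nat.* e) (ke+ke≡n {k} 2k≡f)
    (trans (α^h≈-1 (k Nat.* e) (ke+ke≡n {k} 2k≡f)) (x∙y⁻¹≈ε⇒x≈y (- 1#) 1# -1-1≈0))

  χ-half : ∀ {k i j} → 2 Nat.* k ≡ f → i < ε → j < ε → InC ε j (- 1# - 1#) → χ i k ≡ 𝟙 (i Nat.≟ j)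
  χ-half {k} {i} {j} 2k≡f i<ε j<ε -2∈Cⱼ = 𝟙-cong (InΦ? e ε i z) (i Nat.≟ j) to from
    where
    z = α ^ (k Nat.* e)
    z-1≈-1-1 : z - 1# ≈ - 1# - 1#
    z-1≈-1-1 = +-congʳ (α^h≈-1 (k Nat.* e) (ke+ke≡n {k} 2k≡f))
    to : InΦ e ε i z → i ≡ j
    to (_ , _ , z-1∈Cᵢ) = Cᵋ.InC-unique {i} {j} i<ε j<ε (Cᵋ.InC-resp {i = i} z-1≈-1-1 z-1∈Cᵢ) -2∈Cⱼ
    from : i ≡ j → InΦ e ε i z
    from ≡.refl = Cᵉ.power⇒InC {i = 0} {m = k} (^-congʳ α (ℕₚ.*-comm k e))
                , α^h≉1 (k Nat.* e) (ke+ke≡n {k} 2k≡f)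
                , Cᵋ.InC-resp {i = i} (sym z-1≈-1-1) -2∈Cⱼ

  φ≡2ψ+[i≡j] : ∀ {j} → InC ε 0 (- 1#) → 2 ∣ f → j < ε → InC ε j (- 1# - 1#) →
               ∀ i → i < ε → φ e ε i ≡ 2 Nat.* ψ e f ε i Nat.+ 𝟙 (i Nat.≟ j)
  φ≡2ψ+[i≡j] -1∈C₀ (divides k f≡k*2) j<ε -2∈Cⱼ i i<ε = ≡.trans (φ≡2ψ+middle -1∈C₀ i)
    (≡.cong (2 Nat.* ψ e f ε i Nat.+_) (≡.trans (sum<-middle-even f (χ i) {k} 2k≡f (Nat.>-nonZero⁻¹ f))
                                                  (χ-half {k} 2k≡f i<ε j<ε -2∈Cⱼ)))
    where
    2k≡f : 2 Nat.* k ≡ f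
    2k≡f = ≡.trans (ℕₚ.*-comm 2 k) (≡.sym f≡k*2)

  φ₀-odd : InC ε 0 (- 1#) → 2 ∣ f → 1 < ε → InC ε 0 (- 1# - 1#) →
           φ e ε 0 ≡ 2 Nat.* ψ e f ε 0 Nat.+ 1 × φ e ε 1 ≡ 2 Nat.* ψ e f ε 1
  φ₀-odd -1∈C₀ 2∣f 1<ε -2∈C₀ =
      φ≡2ψ+[i≡j] -1∈C₀ 2∣f (ℕₚ.<⇒≤ 1<ε) -2∈C₀ 0 (ℕₚ.<⇒≤ 1<ε)
    , ≡.trans (φ≡2ψ+[i≡j] -1∈C₀ 2∣f (ℕₚ.<⇒≤ 1<ε) -2∈C₀ 1 1<ε) (ℕₚ.+-identityʳ (2 Nat.* ψ e f ε 1))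

  φ₁-odd : InC ε 0 (- 1#) → 2 ∣ f → 1 < ε → InC ε 1 (- 1# - 1#) →
           φ e ε 0 ≡ 2 Nat.* ψ e f ε 0 × φ e ε 1 ≡ 2 Nat.* ψ e f ε 1 Nat.+ 1
  φ₁-odd -1∈C₀ 2∣f 1<ε -2∈C₁ =
      ≡.trans (φ≡2ψ+[i≡j] -1∈C₀ 2∣f 1<ε -2∈C₁ 0 (ℕₚ.<⇒≤ 1<ε)) (ℕₚ.+-identityʳ (2 Nat.* ψ e f ε 0))
    , φ≡2ψ+[i≡j] -1∈C₀ 2∣f 1<ε -2∈C₁ 1 1<ε

  φ₀-odd-if-constant : InC ε 0 (- 1#) → 2 ∣ f → 2 < ε → (∀ j → 1 ≤ j → j < ε → φ e ε 1 ≡ φ e ε j) →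
                       φ e ε 0 ≡ 2 Nat.* ψ e f ε 0 Nat.+ 1 × φ e ε 1 ≡ 2 Nat.* ψ e f ε 1
  φ₀-odd-if-constant -1∈C₀ 2∣f@(divides k f≡k*2) 2<ε φ-constant =
    φ₀-odd -1∈C₀ 2∣f 1<ε (≡.subst (λ t → InC ε t (- 1# - 1#)) j≡0 -2∈Cⱼ)
    where
    1<ε : 1 < ε
    1<ε = ℕₚ.<-trans (ℕₚ.n<1+n 1) 2<ε
    -2∈some-class : Σ ℕ λ j → j < ε × InC ε j (- 1# - 1#)
    -2∈some-class = Cᵋ.nonzero⇒InC (-1-1≉0 {k} (≡.trans (ℕₚ.*-comm 2 k) (≡.sym f≡k*2)))
    j = proj₁ -2∈some-class
    j<ε = proj₁ (proj₂ -2∈some-class)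
    -2∈Cⱼ = proj₂ (proj₂ -2∈some-class)
    j≡0 : j ≡ 0
    j≡0 = odd-index≡0 (φ e ε) (ψ e f ε) 2<ε j<ε (φ≡2ψ+[i≡j] -1∈C₀ 2∣f j<ε -2∈Cⱼ) φ-constant

  φ₀≡φₕ : ∀ {h} → InC ε h (- 1#) → h Nat.+ h ≡ ε → φ e ε 0 ≡ φ e ε h
  φ₀≡φₕ {h} -1∈Cₕ h+h≡ε = begin
    φ e ε 0                        ≡⟨ φ≡sum<χ 0 ⟩
    sum< f (χ 0)                   ≡⟨ sum<-reflect f (χ 0) (𝟙-no (InΦ? e ε 0 1#) (1∉Φ {0} refl)) (χ-f 0) ⟩
    sum< f (λ r → χ 0 (f ∸ r))     ≡⟨ sum<-cong f (λ r r<f → χ-reflect {h} 0 -1∈Cₕ back r (ℕₚ.<⇒≤ r<f)) ⟩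
    sum< f (χ h)                   ≡⟨ φ≡sum<χ h ⟨
    φ e ε h                        ∎
    where
    open ≡.≡-Reasoning
    back : ∀ {x} → InΦ e ε (h Nat.+ h) x → InΦ e ε 0 x
    back {x} x∈Φ = InΦ-+ε {0} (≡.subst (λ t → InΦ e ε t x) h+h≡ε x∈Φ)

  -1∈C₀-if-2ε∣n : 2 Nat.* ε ∣ n → InC ε 0 (- 1#)
  -1∈C₀-if-2ε∣n (divides s n≡s*2ε) = Cᵋ.power⇒InC {i = 0} {m = s}
    (sym (α^h≈-1 (ε Nat.* s) (≡.trans (regroup ε s) (≡.sym n≡s*2ε))))
    where
    regroup : ∀ ε s → ε Nat.* s Nat.+ ε Nat.* s ≡ s Nat.* (2 Nat.* ε)
    regroup = solve-∀

  -1∈C₀-if-ε-odd : ¬ 2 ∣ ε → InC ε 0 (- 1#)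
  -1∈C₀-if-ε-odd ε-odd with odd⇒≡1+2* ε-odd | nonzero⇒power (invertible⇒≉0 -1*-1≈1)
  ... | a , ε≡1+2a | t , _ , -1≈α^t = Cᵋ.power⇒InC {i = 0} {m = t} (begin
    - 1#                  ≈⟨ -1^[1+2m]≈-1 a ⟨
    (- 1#) ^ suc (2 Nat.* a) ≈⟨ ^-congʳ (- 1#) ε≡1+2a ⟨
    (- 1#) ^ ε            ≈⟨ ^-congˡ ε -1≈α^t ⟩
    (α ^ t) ^ ε           ≈⟨ ^-assocʳ α t ε ⟩
    α ^ (t Nat.* ε)       ≈⟨ ^-congʳ α (ℕₚ.*-comm t ε) ⟩
    α ^ (ε Nat.* t)       ∎)
    where open ≈-Reasoning

  -1∈Cₕ : ∀ {s h} → n ≡ s Nat.* (2 Nat.* ε) Nat.+ ε → h Nat.+ h ≡ ε → InC ε h (- 1#)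
  -1∈Cₕ {s} {h} n≡ h+h≡ε = Cᵋ.power⇒InC {i = h} {m = s} (sym (α^h≈-1 (h Nat.+ ε Nat.* s) exponent))
    where
    regroup : ∀ h ε s → (h Nat.+ ε Nat.* s) Nat.+ (h Nat.+ ε Nat.* s) ≡ s Nat.* (2 Nat.* ε) Nat.+ (h Nat.+ h)
    regroup = solve-∀
    exponent : (h Nat.+ ε Nat.* s) Nat.+ (h Nat.+ ε Nat.* s) ≡ n
    exponent = ≡.trans (regroup h ε s) (≡.trans (≡.cong (s Nat.* (2 Nat.* ε) Nat.+_) h+h≡ε) (≡.sym n≡))

  -1-1∈C₀-if-ε≡2 : ε ≡ 2 → ∀ t → n ≡ t Nat.* 8 → InC ε 0 (- 1# - 1#)
  -1-1∈C₀-if-ε≡2 ε≡2 t n≡8t = Cᵋ.power⇒InC {i = 0} {m = u Nat.+ t}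
    (trans -1-1≈α^[2u+2t] (^-congʳ α (≡.trans (regroup u t) (≡.cong (Nat._* (u Nat.+ t)) (≡.sym ε≡2)))))
    where
    four : ∀ t → ((t Nat.+ t) Nat.+ (t Nat.+ t)) Nat.+ ((t Nat.+ t) Nat.+ (t Nat.+ t)) ≡ t Nat.* 8
    four = solve-∀
    regroup : ∀ u t → (u Nat.+ u) Nat.+ (t Nat.+ t) ≡ 2 Nat.* (u Nat.+ t)
    regroup = solve-∀
    u = proj₁ (-1-1≈α^[u+u+t] {t Nat.+ t} (≡.trans (four t) (≡.sym n≡8t)))
    -1-1≈α^[2u+2t] : - 1# - 1# ≈ α ^ ((u Nat.+ u) Nat.+ (t Nat.+ t))
    -1-1≈α^[2u+2t] = proj₂ (-1-1≈α^[u+u+t] {t Nat.+ t} (≡.trans (four t) (≡.sym n≡8t)))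

  -1-1∈C₁-if-ε≡2 : ε ≡ 2 → ∀ t → n ≡ t Nat.* 8 Nat.+ 4 → InC ε 1 (- 1# - 1#)
  -1-1∈C₁-if-ε≡2 ε≡2 t n≡8t+4 = Cᵋ.power⇒InC {i = 1} {m = u Nat.+ t}
    (trans -1-1≈α^[2u+2t+1] (^-congʳ α (≡.trans (regroup u t) (≡.cong (λ z → 1 Nat.+ z Nat.* (u Nat.+ t)) (≡.sym ε≡2)))))
    where
    four : ∀ t → ((t Nat.+ t Nat.+ 1) Nat.+ (t Nat.+ t Nat.+ 1)) Nat.+ ((t Nat.+ t Nat.+ 1) Nat.+ (t Nat.+ t Nat.+ 1))
               ≡ t Nat.* 8 Nat.+ 4
    four = solve-∀
    regroup : ∀ u t → (u Nat.+ u) Nat.+ (t Nat.+ t Nat.+ 1) ≡ 1 Nat.+ 2 Nat.* (u Nat.+ t)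
    regroup = solve-∀
    u = proj₁ (-1-1≈α^[u+u+t] {t Nat.+ t Nat.+ 1} (≡.trans (four t) (≡.sym n≡8t+4)))
    -1-1≈α^[2u+2t+1] : - 1# - 1# ≈ α ^ ((u Nat.+ u) Nat.+ (t Nat.+ t Nat.+ 1))
    -1-1≈α^[2u+2t+1] = proj₂ (-1-1≈α^[u+u+t] {t Nat.+ t Nat.+ 1} (≡.trans (four t) (≡.sym n≡8t+4)))

  private
    n≡2εs+ε : 2 Nat.* ε ∣ n ∸ ε → Σ ℕ λ s → n ≡ s Nat.* (2 Nat.* ε) Nat.+ ε
    n≡2εs+ε (divides s n∸ε≡s*2ε) = s , ≡.trans (≡.sym (ℕₚ.m∸n+n≡m ε≤n)) (≡.cong (Nat._+ ε) n∸ε≡s*2ε)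
      where
      ε≤n : ε ≤ n
      ε≤n = ≡.subst (ε ≤_) ε*ρ≡e*f (ℕₚ.m≤m*n ε ρ {{ℕₚ.m*n≢0⇒n≢0 ε {{≡.subst NonZero (≡.sym ε*ρ≡e*f) ef≢0}}}})

  φ≡2ψ-if-ε-odd : 2 Nat.* ε ∣ n ∸ ε → ¬ 2 ∣ ε → ∀ i → φ e ε i ≡ 2 Nat.* ψ e f ε i
  φ≡2ψ-if-ε-odd 2ε∣n∸ε ε-odd = φ≡2ψ (-1∈C₀-if-ε-odd ε-odd) f-odd
    where
    f-odd : ¬ 2 ∣ f
    f-odd 2∣f with n≡2εs+ε 2ε∣n∸ε
    ... | s , n≡2εs+ε′ = 2∤2εs+ε s ε-odd (≡.subst (2 ∣_) n≡2εs+ε′ (∣n⇒∣m*n e 2∣f))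

  φ₀≡φ[ε/2] : 2 Nat.* ε ∣ n ∸ ε → 2 ∣ ε → φ e ε 0 ≡ φ e ε (ε / 2)
  φ₀≡φ[ε/2] 2ε∣n∸ε (divides h ε≡h*2) =
    ≡.subst (λ t → φ e ε 0 ≡ φ e ε t) (≡.sym ε/2≡h) (φ₀≡φₕ {h} (-1∈Cₕ {s} {h} (proj₂ (n≡2εs+ε 2ε∣n∸ε)) h+h≡ε) h+h≡ε)
    where
    s = proj₁ (n≡2εs+ε 2ε∣n∸ε)
    ε/2≡h : ε / 2 ≡ h
    ε/2≡h = ≡.trans (≡.cong (_/ 2) ε≡h*2) (Data.Nat.DivMod.m*n/n≡m h 2)
    h+h≡ε : h Nat.+ h ≡ ε
    h+h≡ε = ≡.trans (≡.cong (h Nat.+_) (≡.sym (ℕₚ.+-identityʳ h))) (≡.trans (ℕₚ.*-comm 2 h) (≡.sym ε≡h*2))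

open import Data.Nat using (_+_; _*_; _^_)
open import Data.Nat.Primality using (Prime)

module ResiduesOfQ {q n : ℕ} (q≡n+1 : q ≡ n + 1) where

  private
    q≡1+n : q ≡ suc n
    q≡1+n = ≡.trans q≡n+1 (ℕₚ.+-comm n 1)

    q≡[q%8]+8[q/8] : q ≡ q % 8 + (q / 8) * 8
    q≡[q%8]+8[q/8] = Data.Nat.DivMod.m≡m%n+[m/n]*n q 8

  q∸1≡n : q ∸ 1 ≡ n
  q∸1≡n = ≡.cong (_∸ 1) q≡1+n

  q∸[ε+1]≡n∸ε : ∀ ε → q ∸ (ε + 1) ≡ n ∸ ε
  q∸[ε+1]≡n∸ε ε = ≡.trans (≡.cong (_∸ (ε + 1)) q≡1+n) (≡.cong (suc n ∸_) (ℕₚ.+-comm ε 1))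

  q%8≡1⇒n≡8t : q % 8 ≡ 1 → n ≡ (q / 8) * 8
  q%8≡1⇒n≡8t q%8≡1 = ℕₚ.suc-injective (≡.trans (≡.sym q≡1+n) (≡.trans q≡[q%8]+8[q/8] (≡.cong (_+ (q / 8) * 8) q%8≡1)))

  q%8≡5⇒n≡8t+4 : q % 8 ≡ 5 → n ≡ (q / 8) * 8 + 4
  q%8≡5⇒n≡8t+4 q%8≡5 = ℕₚ.suc-injective (≡.trans (≡.sym q≡1+n)
    (≡.trans q≡[q%8]+8[q/8] (≡.trans (≡.cong (_+ (q / 8) * 8) q%8≡5) (≡.trans (ℕₚ.+-comm 5 ((q / 8) * 8)) (ℕₚ.+-suc ((q / 8) * 8) 4)))))

theorem3p16 : {c ℓ : Level} (q e f ε ρ : ℕ) (F : FiniteField c ℓ q) →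
    (Σ ℕ λ p → Σ ℕ λ k → Prime p × 1 ≤ k × q ≡ p ^ k) →
    q ≡ e * f + 1 → q ≡ ε * ρ + 1 →
    1 < e → 1 < f → 1 < ε → 1 < ρ → ε ∣ e →
    let φ = Cyclotomy.φ F e ε
        ψ = Cyclotomy.ψ F e f ε
    in
    -- (a)
    ((2 * ε ∣ q ∸ 1) → (∀ j → 1 ≤ j → j < ε → φ 1 ≡ φ j) →
        (¬ (2 ∣ f) → φ 0 ≡ 2 * ψ 0 × φ 1 ≡ 2 * ψ 1)
      × (2 ∣ f → 2 < ε → φ 0 ≡ 2 * ψ 0 + 1 × φ 1 ≡ 2 * ψ 1)
      × (2 ∣ f → ε ≡ 2 → q % 8 ≡ 1 → φ 0 ≡ 2 * ψ 0 + 1 × φ 1 ≡ 2 * ψ 1)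
      × (2 ∣ f → ε ≡ 2 → q % 8 ≡ 5 → φ 0 ≡ 2 * ψ 0 × φ 1 ≡ 2 * ψ 1 + 1))
    -- (b)
    × ((2 * ε ∣ q ∸ (ε + 1)) → ¬ (2 ∣ ε) → (∀ j → 1 ≤ j → j < ε → φ 1 ≡ φ j) →
        φ 0 ≡ 2 * ψ 0 × φ 1 ≡ 2 * ψ 1)
    -- (c)
    × ((2 * ε ∣ q ∸ (ε + 1)) → 2 ∣ ε → φ 0 ≡ φ (ε / 2))
theorem3p16 q e f ε ρ F _ q≡ef+1 q≡ερ+1 1<e 1<f 1<ε 1<ρ ε∣e =
    (λ 2ε∣q∸1 φ-constant → let -1∈C₀ = -1∈C₀-if-2ε∣n (≡.subst (2 * ε ∣_) q∸1≡n 2ε∣q∸1) in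
        (λ f-odd → φ≡2ψ -1∈C₀ f-odd 0 , φ≡2ψ -1∈C₀ f-odd 1)
      , (λ 2∣f 2<ε → φ₀-odd-if-constant -1∈C₀ 2∣f 2<ε φ-constant)
      , (λ 2∣f ε≡2 q%8≡1 → φ₀-odd -1∈C₀ 2∣f 1<ε (-1-1∈C₀-if-ε≡2 ε≡2 (q / 8) (q%8≡1⇒n≡8t q%8≡1)))
      , (λ 2∣f ε≡2 q%8≡5 → φ₁-odd -1∈C₀ 2∣f 1<ε (-1-1∈C₁-if-ε≡2 ε≡2 (q / 8) (q%8≡5⇒n≡8t+4 q%8≡5))))
  , (λ 2ε∣q∸[ε+1] ε-odd _ → let 2ε∣n∸ε = ≡.subst (2 * ε ∣_) (q∸[ε+1]≡n∸ε ε) 2ε∣q∸[ε+1] in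
        φ≡2ψ-if-ε-odd 2ε∣n∸ε ε-odd 0 , φ≡2ψ-if-ε-odd 2ε∣n∸ε ε-odd 1)
  , (λ 2ε∣q∸[ε+1] → φ₀≡φ[ε/2] (≡.subst (2 * ε ∣_) (q∸[ε+1]≡n∸ε ε) 2ε∣q∸[ε+1]))
  where
  open ResiduesOfQ q≡ef+1
  ε*ρ≡e*f : ε * ρ ≡ e * f
  ε*ρ≡e*f = ℕₚ.+-cancelʳ-≡ 1 (ε * ρ) (e * f) (≡.trans (≡.sym q≡ερ+1) q≡ef+1)
  instance
    ef≢0 : NonZero (e * f)
    ef≢0 = ℕₚ.m*n≢0 e f {{Nat.>-nonZero (ℕₚ.<-trans (Nat.s≤s Nat.z≤n) 1<e)}} {{Nat.>-nonZero (ℕₚ.<-trans (Nat.s≤s Nat.z≤n) 1<f)}}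
  open CyclotomicNumbers F (≡.trans q≡ef+1 (ℕₚ.+-comm (e * f) 1)) ε*ρ≡e*f ε∣e
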